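{- Let $N\ge 1$, let $D$ be an integer, and let $I$ be an integer coprime to $N$. Boxes are labeled by the residues modulo $N$, and keys $1,\dots,N$ are placed in the $N$ boxes according to a uniformly random bijection $\pi$ (key $k$ lies in box $\pi(k) \bmod N$). Under the box strategy with offset $D$ and increment $I$ and with $a$ attempts ($0\le a\le N$), prisoner $P_i$ ($1\le i\le N$) finds her key if and only if $\pi(i)\equiv i+D+jI \pmod N$ for some $0\le j\le a-1$. Let $P_{\rm BS}(a,w)$ be the probability that exactly $w$ prisoners find their key. Then for all $1\le a\le N$ and $0\le w\le N$, $$P_{\rm BS}(a,w)=P_{\rm BS}(N-a,N-w).$$
   Context: In the box strategy each prisoner $P_i$ opens successively the boxes $i+D,\ i+D+I,\ i+D+2I,\dots \pmod N$ until she finds key $i$ or has opened $a$ boxes. For $a=0$ no box is opened, so $P_{\rm BS}(0,w)$ equals $1$ if $w=0$ and $0$ otherwise. -}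

module Defs where

open import Data.Bool using (Bool)
open import Data.Bool.ListAction using (any)
open import Data.Nat using (ℕ; zero; suc; NonZero; _≡ᵇ_; _!)
open import Data.Nat.Properties using (_!≢0)
open import Data.Integer using (ℤ; +_; _+_; _*_)
open import Data.Integer.DivMod using (_%ℕ_)
open import Data.Fin using (Fin; toℕ)
open import Data.Fin.Properties using (_≟_)
open import Data.List using (List; []; _∷_; [_]; map; concatMap; filter; filterᵇ; length; upTo; allFin)
open import Data.Vec using (Vec; lookup) renaming ([] to []ᵥ; _∷_ to _∷ᵥ_)
open import Data.Vec.Relation.Unary.AllPairs using (allPairs?)
open import Relation.Nullary using (¬?)
open import Data.Rational using (ℚ; _/_)

allVecs : (N m : ℕ) → List (Vec (Fin N) m)
allVecs N zero    = [ []ᵥ ]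
allVecs N (suc m) = concatMap (λ x → map (x ∷ᵥ_) (allVecs N m)) (allFin N)

-- An arrangement π : lookup π k = box (a residue mod N, i.e. an element of Fin N)
-- containing key (k+1), for k : Fin N.  π is a bijection iff its entries are
-- pairwise distinct (Unique = AllPairs _≢_).
bijections : (N : ℕ) → List (Vec (Fin N) N)
bijections N = filter (allPairs? (λ x y → ¬? (x ≟ y))) (allVecs N N)

finds : (N : ℕ) .{{_ : NonZero N}} (D I : ℤ) (a : ℕ) → Vec (Fin N) N → Fin N → Bool
finds N D I a π k = any (λ j → toℕ (lookup π k) ≡ᵇ ((+ suc (toℕ k) + D + (+ j) * I) %ℕ N)) (upTo a)

numFound : (N : ℕ) .{{_ : NonZero N}} (D I : ℤ) (a : ℕ) → Vec (Fin N) N → ℕ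
numFound N D I a π = length (filterᵇ (finds N D I a π) (allFin N))

countBS : (N : ℕ) .{{_ : NonZero N}} (D I : ℤ) (a w : ℕ) → ℕ
countBS N D I a w = length (filterᵇ (λ π → numFound N D I a π ≡ᵇ w) (bijections N))

P-BS : (N : ℕ) .{{_ : NonZero N}} (D I : ℤ) (a w : ℕ) → ℚ
P-BS N D I a w = _/_ (+ countBS N D I a w) (N !) {{N !≢0}}

-- Relabel every box b as b + aI (mod N).  Since j ↦ s + jI is a bijection of
-- ℤ/N (I is coprime to N), prisoner i's box π(i) lies on the first N − a
-- points of her orbit s, s + I, …, s + (N−1)I (s = i + D) exactly when π(i) + aI does not
-- lie on the first a points.  So after relabelling, the prisoners that succeed
-- with N − a attempts are precisely those that fail with a attempts; and as the
-- relabelling permutes the arrangements, w successes with a attempts are as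
-- likely as N − w successes with N − a attempts.
module Submission where

open import Defs
open import Data.Bool using (Bool; true; false; not; T)
open import Data.Bool.ListAction using (any)
open import Data.Empty using (⊥; ⊥-elim)
open import Data.Fin using (Fin; toℕ; fromℕ<; punchOut)
open import Data.Fin.Properties
  using (any?; punchOut-injective; injective⇒≤; toℕ-injective; toℕ<n; toℕ-fromℕ<)
  renaming (_≟_ to _≟ᶠ_)
open import Data.Integer using (ℤ; +_; _+_; _-_; _*_; -_; ∣_∣; _%ℕ_; _/ℕ_)
open import Data.Integer.DivMod using (a≡a%ℕn+[a/ℕn]*n; n%ℕd<d)
open import Data.Integer.Divisibility.Signed
  using (_∣_; divides; ∣⇒∣ᵤ; ∣ᵤ⇒∣; ∣m∣n⇒∣m+n; ∣m⇒∣-m)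
open import Data.Integer.Properties
  using ([+m]-[+n]≡m⊖n; ∣m⊝n∣≤m⊔n; ∣i∣≡0⇒i≡0; i-j≡0⇒i≡j; +-injective; abs-*; pos-+)
open import Data.Integer.Tactic.RingSolver using (solve-∀)
open import Data.List
  using (List; []; _∷_; map; concatMap; filter; filterᵇ; length; upTo; allFin)
open import Data.List.Properties
  using (length-map; length-tabulate; filter-≐; map-concatMap; concatMap-map; concatMap-cong; map-∘)
open import Data.List.Membership.Propositional using (_∈_)
open import Data.List.Membership.Propositional.Properties using (∈-map⁺; ∈-allFin)
open import Data.List.Membership.Propositional.Properties.WithK using (unique∧set⇒bag)
open import Data.List.Relation.Binary.BagAndSetEquality using (∼bag⇒↭; ↭⇒∼bag; >>=-cong)
open import Data.List.Relation.Binary.Permutation.Propositional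
  using (_↭_; ↭-refl; module PermutationReasoning)
open import Data.List.Relation.Binary.Permutation.Propositional.Properties
  using (↭-length; filter-↭; map⁺)
open import Data.List.Relation.Unary.Any.Properties using (any⁺; any⁻; applyUpTo⁺; applyUpTo⁻)
open import Data.List.Relation.Unary.Unique.Propositional.Properties using (allFin⁺)
  renaming (map⁺ to unique-map⁺)
open import Data.Nat as ℕ using (ℕ; zero; suc; NonZero; _≤_; _<_; _∸_; _≡ᵇ_; _!)
import Data.Nat.Properties as ℕ
open import Data.Nat.Coprimality using (Coprime; coprime-divisor)
open import Data.Nat.Divisibility using (>⇒∤) renaming (_∣_ to _∣ℕ_)
open import Data.Product using (∃; _×_; _,_)
open import Data.Rational using (_/_)
open import Data.Vec as Vec using (Vec; lookup)
open import Data.Vec.Properties using (lookup-map)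
import Data.Vec.Relation.Unary.All as All
import Data.Vec.Relation.Unary.All.Properties as All
open import Data.Vec.Relation.Unary.AllPairs using ([]; _∷_; allPairs?)
open import Data.Vec.Relation.Unary.Unique.Propositional using (Unique)
import Data.Vec.Relation.Unary.Unique.Propositional.Properties as Unique
open import Function using (_∘_; _⇔_; mk⇔; Equivalence; Injective)
open import Relation.Nullary using (¬_; ¬?; yes; no; does; contradiction)
open import Relation.Nullary.Decidable using (T?)
open import Relation.Unary using (Decidable)
open import Relation.Binary.PropositionalEquality
  using (_≡_; _≗_; refl; sym; trans; cong; subst; module ≡-Reasoning)

private
  variable
    A B : Set

T-⇔⇒≡ : ∀ {x y} → T x ⇔ T y → x ≡ y
T-⇔⇒≡ {false} {false} _ = refl
T-⇔⇒≡ {false} {true}  e = ⊥-elim (Equivalence.from e _)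
T-⇔⇒≡ {true}  {false} e = ⊥-elim (Equivalence.to e _)
T-⇔⇒≡ {true}  {true}  _ = refl

T-not⇔¬T : ∀ {x} → T (not x) ⇔ (¬ T x)
T-not⇔¬T {false} = mk⇔ (λ _ ()) (λ _ → _)
T-not⇔¬T {true}  = mk⇔ (λ ()) (λ ¬t → ¬t _)

T-any-upTo : ∀ (p : ℕ → Bool) n → T (any p (upTo n)) ⇔ (∃ λ j → j < n × T (p j))
T-any-upTo p n = mk⇔ (λ t → applyUpTo⁻ (λ j → j) (any⁻ p (upTo n) t))
                     (λ (j , j<n , pj) → any⁺ p (applyUpTo⁺ (λ j → j) pj j<n))

≡ᵇ-∸ : ∀ {n x y} → x ≤ n → y ≤ n → (x ≡ᵇ y) ≡ (n ∸ x ≡ᵇ n ∸ y)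
≡ᵇ-∸ {n} {x} {y} x≤n y≤n = T-⇔⇒≡ (mk⇔
  (λ t → ℕ.≡⇒≡ᵇ _ _ (cong (n ∸_) (ℕ.≡ᵇ⇒≡ x y t)))
  (λ t → ℕ.≡⇒≡ᵇ _ _ (ℕ.∸-cancelˡ-≡ x≤n y≤n (ℕ.≡ᵇ⇒≡ _ _ t))))

count : (A → Bool) → List A → ℕ
count p xs = length (filterᵇ p xs)

filter-map : ∀ {P : B → Set} (P? : Decidable P) (f : A → B) xs →
             filter P? (map f xs) ≡ map f (filter (P? ∘ f) xs)
filter-map P? f [] = refl
filter-map P? f (x ∷ xs) with does (P? (f x))
... | true  = cong (f x ∷_) (filter-map P? f xs)
... | false = filter-map P? f xs

count-map : ∀ (p : B → Bool) (f : A → B) xs → count p (map f xs) ≡ count (p ∘ f) xs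
count-map p f xs = trans (cong length (filter-map (T? ∘ p) f xs)) (length-map f (filterᵇ (p ∘ f) xs))

count-↭ : ∀ (p : A → Bool) {xs ys} → xs ↭ ys → count p xs ≡ count p ys
count-↭ p xs↭ys = ↭-length (filter-↭ (T? ∘ p) xs↭ys)

count-cong : ∀ {p q : A → Bool} → p ≗ q → ∀ xs → count p xs ≡ count q xs
count-cong {p = p} {q} p≗q xs =
  cong length (filter-≐ (T? ∘ p) (T? ∘ q)
    ((λ {x} → subst T (p≗q x)) , (λ {x} → subst T (sym (p≗q x)))) xs)

count-not+count : ∀ (p : A → Bool) xs → count (not ∘ p) xs ℕ.+ count p xs ≡ length xs
count-not+count p [] = refl
count-not+count p (x ∷ xs) with p x
... | true  = trans (ℕ.+-suc _ _) (cong suc (count-not+count p xs))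
... | false = cong suc (count-not+count p xs)

count-not : ∀ (p : A → Bool) xs → count (not ∘ p) xs ≡ length xs ∸ count p xs
count-not p xs = trans (sym (ℕ.m+n∸n≡m _ (count p xs))) (cong (_∸ count p xs) (count-not+count p xs))

count-≤-length : ∀ (p : A → Bool) xs → count p xs ≤ length xs
count-≤-length p xs = subst (count p xs ≤_) (count-not+count p xs) (ℕ.m≤n+m _ _)

concatMap⁺ : ∀ {f g : A → List B} {xs ys} → xs ↭ ys → (∀ x → f x ↭ g x) →
             concatMap f xs ↭ concatMap g ys
concatMap⁺ xs↭ys f↭g = ∼bag⇒↭ (>>=-cong (↭⇒∼bag xs↭ys) (λ x → ↭⇒∼bag (f↭g x)))

injective⇒surjective : ∀ {n} {f : Fin n → Fin n} → Injective _≡_ _≡_ f → ∀ y → ∃ λ x → f x ≡ y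
injective⇒surjective {zero}          _     ()
injective⇒surjective {suc n} {f} f-inj y with any? (λ x → f x ≟ᶠ y)
... | yes hit = hit
... | no miss = contradiction (injective⇒≤ f′-inj) ℕ.1+n≰n
  where
  y≢f : ∀ x → y ≡ f x → ⊥
  y≢f x y≡fx = miss (x , sym y≡fx)

  f′ : Fin (suc n) → Fin n
  f′ x = punchOut (y≢f x)

  f′-inj : Injective _≡_ _≡_ f′
  f′-inj {x} {x′} = f-inj ∘ punchOut-injective (y≢f x) (y≢f x′)

map-allFin-↭ : ∀ {n} {f : Fin n → Fin n} → Injective _≡_ _≡_ f → map f (allFin n) ↭ allFin n
map-allFin-↭ {n} {f} f-inj = ∼bag⇒↭ (unique∧set⇒bag
  (unique-map⁺ f-inj (allFin⁺ n)) (allFin⁺ n)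
  (λ {y} → mk⇔ (λ _ → ∈-allFin y) (λ _ → hit y (injective⇒surjective f-inj y))))
  where
  hit : ∀ y → (∃ λ x → f x ≡ y) → y ∈ map f (allFin n)
  hit y (x , refl) = ∈-map⁺ f (∈-allFin x)

allVecs-map-↭ : ∀ {n} {f : Fin n → Fin n} → Injective _≡_ _≡_ f →
                ∀ m → map (Vec.map f) (allVecs n m) ↭ allVecs n m
allVecs-map-↭ f-inj zero = ↭-refl
allVecs-map-↭ {n} {f} f-inj (suc m) = begin
  map (Vec.map f) (concatMap extend (allFin n))
    ≡⟨ map-concatMap (Vec.map f) extend (allFin n) ⟩
  concatMap (λ x → map (Vec.map f) (extend x)) (allFin n)
    -- Vec.map f ∘ (x ∷_) is definitionally (f x ∷_) ∘ Vec.map f.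
    ≡⟨ concatMap-cong (λ x → trans (sym (map-∘ (allVecs n m))) (map-∘ (allVecs n m))) (allFin n) ⟩
  concatMap (λ x → map (f x Vec.∷_) (map (Vec.map f) (allVecs n m))) (allFin n)
    ↭⟨ concatMap⁺ {xs = allFin n} ↭-refl (λ x → map⁺ (f x Vec.∷_) (allVecs-map-↭ f-inj m)) ⟩
  concatMap (extend ∘ f) (allFin n)
    ≡⟨ concatMap-map extend f (allFin n) ⟨
  concatMap extend (map f (allFin n))
    ↭⟨ concatMap⁺ {f = extend} (map-allFin-↭ f-inj) (λ _ → ↭-refl) ⟩
  concatMap extend (allFin n) ∎
  where
  open PermutationReasoning
  extend : Fin n → List (Vec (Fin n) (suc m))
  extend x = map (x Vec.∷_) (allVecs n m)

unique-map⁻ : ∀ (f : A → B) {n} {xs : Vec A n} → Unique (Vec.map f xs) → Unique xs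
unique-map⁻ f {xs = Vec.[]}     []         = []
unique-map⁻ f {xs = x Vec.∷ xs} (fx∉ ∷ u) =
  All.map (λ fx≢fy → fx≢fy ∘ cong f) (All.map⁻ fx∉) ∷ unique-map⁻ f u

bijections-map-↭ : ∀ {n} {f : Fin n → Fin n} → Injective _≡_ _≡_ f →
                   map (Vec.map f) (bijections n) ↭ bijections n
bijections-map-↭ {n} {f} f-inj = begin
  map (Vec.map f) (filter unique? (allVecs n n))
    ≡⟨ cong (map (Vec.map f)) (filter-≐ unique? (unique? ∘ Vec.map f)
         (Unique.map⁺ f-inj , unique-map⁻ f) (allVecs n n)) ⟩
  map (Vec.map f) (filter (unique? ∘ Vec.map f) (allVecs n n))
    ≡⟨ filter-map unique? (Vec.map f) (allVecs n n) ⟨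
  filter unique? (map (Vec.map f) (allVecs n n))
    ↭⟨ filter-↭ unique? (allVecs-map-↭ f-inj n) ⟩
  filter unique? (allVecs n n) ∎
  where
  open PermutationReasoning
  unique? : Decidable (Unique {n = n})
  unique? = allPairs? (λ x y → ¬? (x ≟ᶠ y))

infix 4 _≡_mod_

-- A record rather than a function, so that x, y and n are inferable from the type.
record _≡_mod_ (x y : ℤ) (n : ℕ) : Set where
  constructor ∣⇒≡mod
  field ≡mod⇒∣ : + n ∣ x - y

private
  neg-sub : ∀ x y → - (x - y) ≡ y - x
  neg-sub = solve-∀

  sub-telescope : ∀ x y z → (x - y) + (y - z) ≡ x - z
  sub-telescope = solve-∀

  sub-+ʳ : ∀ x y z → (x + z) - (y + z) ≡ x - y
  sub-+ʳ = solve-∀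

  sub-+ˡ : ∀ z x y → (z + x) - (z + y) ≡ x - y
  sub-+ˡ = solve-∀

  sub-*ʳ : ∀ x y c → x * c - y * c ≡ (x - y) * c
  sub-*ʳ = solve-∀

  residue-sub : ∀ r q m → r - (r + q * m) ≡ (- q) * m
  residue-sub = solve-∀

module _ {n : ℕ} where

  ≡mod-sym : ∀ {x y} → x ≡ y mod n → y ≡ x mod n
  ≡mod-sym {x} {y} (∣⇒≡mod d) = ∣⇒≡mod (subst (+ n ∣_) (neg-sub x y) (∣m⇒∣-m d))

  ≡mod-trans : ∀ {x y z} → x ≡ y mod n → y ≡ z mod n → x ≡ z mod n
  ≡mod-trans {x} {y} {z} (∣⇒≡mod d) (∣⇒≡mod e) =
    ∣⇒≡mod (subst (+ n ∣_) (sub-telescope x y z) (∣m∣n⇒∣m+n d e))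

  +-congʳ-≡mod : ∀ {x y} z → x ≡ y mod n → x + z ≡ y + z mod n
  +-congʳ-≡mod {x} {y} z (∣⇒≡mod d) = ∣⇒≡mod (subst (+ n ∣_) (sym (sub-+ʳ x y z)) d)

  +-cancelˡ-≡mod : ∀ z {x y} → z + x ≡ z + y mod n → x ≡ y mod n
  +-cancelˡ-≡mod z {x} {y} (∣⇒≡mod d) = ∣⇒≡mod (subst (+ n ∣_) (sub-+ˡ z x y) d)

  +-cancelʳ-≡mod : ∀ {x y} z → x + z ≡ y + z mod n → x ≡ y mod n
  +-cancelʳ-≡mod {x} {y} z (∣⇒≡mod d) = ∣⇒≡mod (subst (+ n ∣_) (sub-+ʳ x y z) d)

  *-cancelʳ-≡mod : ∀ {x y c} → Coprime n ∣ c ∣ → x * c ≡ y * c mod n → x ≡ y mod n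
  *-cancelʳ-≡mod {x} {y} {c} n⊥c (∣⇒≡mod d) = ∣⇒≡mod (∣ᵤ⇒∣ (coprime-divisor n⊥c
    (subst (n ∣ℕ_) (trans (abs-* (x - y) c) (ℕ.*-comm ∣ x - y ∣ ∣ c ∣))
      (∣⇒∣ᵤ (subst (+ n ∣_) (sub-*ʳ x y c) d)))))

  ∣∧<⇒≡0 : ∀ {m} → n ∣ℕ m → m < n → m ≡ 0
  ∣∧<⇒≡0 {zero}  _   _   = refl
  ∣∧<⇒≡0 {suc m} n∣m m<n = contradiction n∣m (>⇒∤ m<n)

  residue-unique : ∀ {m k} → m < n → k < n → + m ≡ + k mod n → m ≡ k
  residue-unique {m} {k} m<n k<n (∣⇒≡mod d) = +-injective (i-j≡0⇒i≡j (+ m) (+ k)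
    (∣i∣≡0⇒i≡0 (∣∧<⇒≡0 (∣⇒∣ᵤ d) ∣m-k∣<n)))
    where
    ∣m-k∣<n : ∣ + m - + k ∣ < n
    ∣m-k∣<n = subst (_< n) (cong ∣_∣ (sym ([+m]-[+n]≡m⊖n m k)))
                (ℕ.≤-<-trans (∣m⊝n∣≤m⊔n m k) (ℕ.⊔-lub m<n k<n))

  module _ .{{_ : NonZero n}} where

    %ℕ-≡mod : ∀ x → + (x %ℕ n) ≡ x mod n
    %ℕ-≡mod x = ∣⇒≡mod (divides (- (x /ℕ n)) (begin
      + (x %ℕ n) - x                           ≡⟨ cong (λ y → + (x %ℕ n) - y) (a≡a%ℕn+[a/ℕn]*n x n) ⟩
      + (x %ℕ n) - (+ (x %ℕ n) + x /ℕ n * + n) ≡⟨ residue-sub (+ (x %ℕ n)) (x /ℕ n) (+ n) ⟩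
      - (x /ℕ n) * + n                         ∎))
      where open ≡-Reasoning

    ≡%ℕ⇔≡mod : ∀ {m x} → m < n → (m ≡ x %ℕ n) ⇔ (+ m ≡ x mod n)
    ≡%ℕ⇔≡mod {m} {x} m<n = mk⇔
      (λ m≡x%n → subst (λ r → + r ≡ x mod n) (sym m≡x%n) (%ℕ-≡mod x))
      (λ m≡x → residue-unique m<n (n%ℕd<d x n) (≡mod-trans m≡x (≡mod-sym (%ℕ-≡mod x))))

    reduce : ℤ → Fin n
    reduce x = fromℕ< (n%ℕd<d x n)

    reduce-≡mod : ∀ x → + toℕ (reduce x) ≡ x mod n
    reduce-≡mod x = subst (λ r → + r ≡ x mod n) (sym (toℕ-fromℕ< (n%ℕd<d x n))) (%ℕ-≡mod x)

    reduce-≡⇒≡mod : ∀ {x y} → reduce x ≡ reduce y → x ≡ y mod n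
    reduce-≡⇒≡mod {x} {y} rx≡ry =
      ≡mod-trans (≡mod-sym (reduce-≡mod x))
                 (subst (λ r → + toℕ r ≡ y mod n) (sym rx≡ry) (reduce-≡mod y))

module BoxStrategy (N : ℕ) .{{_ : NonZero N}} (I : ℤ) (N⊥I : Coprime N ∣ I ∣) where

  Reaches : ℤ → ℕ → ℤ → Set
  Reaches s b x = ∃ λ j → j < b × x ≡ s + + j * I mod N

  Reaches-resp-≡mod : ∀ s {b x y} → x ≡ y mod N → Reaches s b x → Reaches s b y
  Reaches-resp-≡mod s x≡y (j , j<b , x≡) = j , j<b , ≡mod-trans (≡mod-sym x≡y) x≡

  orbit-injective : ∀ s {i j} → i < N → j < N → s + + i * I ≡ s + + j * I mod N → i ≡ j
  orbit-injective s i<N j<N eq = residue-unique i<N j<N (*-cancelʳ-≡mod N⊥I (+-cancelˡ-≡mod s eq))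

  orbit-+ : ∀ s i j → s + + (i ℕ.+ j) * I ≡ (s + + i * I) + + j * I
  orbit-+ s i j = trans (cong (λ k → s + k * I) (pos-+ i j)) (distrib s (+ i) (+ j) I)
    where
    distrib : ∀ s i j c → s + (i + j) * c ≡ (s + i * c) + j * c
    distrib = solve-∀

  -- Pigeonhole: j ↦ s + jI is injective on Fin N, hence onto.
  Reaches-all : ∀ s x → Reaches s N x
  Reaches-all s x =
    let j , oj≡rx = injective⇒surjective orbit-inj (reduce x)
    in  toℕ j , toℕ<n j , ≡mod-sym (reduce-≡⇒≡mod oj≡rx)
    where
    orbit : Fin N → Fin N
    orbit j = reduce (s + + toℕ j * I)

    orbit-inj : Injective _≡_ _≡_ orbit
    orbit-inj {i} {j} oi≡oj = toℕ-injective (orbit-injective s (toℕ<n i) (toℕ<n j) (reduce-≡⇒≡mod oi≡oj))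

  Reaches-shift-disjoint : ∀ s {a x} → a ≤ N → Reaches s (N ∸ a) x → ¬ Reaches s a (x + + a * I)
  Reaches-shift-disjoint s {a} {x} a≤N (i , i<N∸a , x≡) (j , j<a , x+aI≡) =
    ℕ.<⇒≱ j<a (subst (a ≤_) i+a≡j (ℕ.m≤n+m a i))
    where
    i+a<N : i ℕ.+ a < N
    i+a<N = subst (i ℕ.+ a <_) (ℕ.m∸n+n≡m a≤N) (ℕ.+-monoˡ-< a i<N∸a)

    i+a≡j : i ℕ.+ a ≡ j
    i+a≡j = orbit-injective s i+a<N (ℕ.<-≤-trans j<a a≤N)
      (subst (_≡ s + + j * I mod N) (sym (orbit-+ s i a))
        (≡mod-trans (+-congʳ-≡mod (+ a * I) (≡mod-sym x≡)) x+aI≡))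

  Reaches-shift-cover : ∀ s {a x} → a ≤ N → ¬ Reaches s a (x + + a * I) → Reaches s (N ∸ a) x
  Reaches-shift-cover s {a} {x} a≤N unreached = cover (Reaches-all s (x + + a * I))
    where
    cover : Reaches s N (x + + a * I) → Reaches s (N ∸ a) x
    cover (j , j<N , x+aI≡) with j ℕ.<? a
    ... | yes j<a = contradiction (j , j<a , x+aI≡) unreached
    ... | no  j≮a = j ∸ a , ℕ.∸-monoˡ-< j<N a≤j , +-cancelʳ-≡mod (+ a * I)
            (subst (x + + a * I ≡_mod N) (trans (cong (λ k → s + + k * I) (sym (ℕ.m∸n+n≡m a≤j)))
                                               (orbit-+ s (j ∸ a) a)) x+aI≡)
      where
      a≤j : a ≤ j
      a≤j = ℕ.≮⇒≥ j≮a

  module _ (D : ℤ) {a : ℕ} (a≤N : a ≤ N) where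

    start : Fin N → ℤ
    start k = + suc (toℕ k) + D

    finds⇔Reaches : ∀ b π k → T (finds N D I b π k) ⇔ Reaches (start k) b (+ toℕ (lookup π k))
    finds⇔Reaches b π k = mk⇔
      (λ t → let j , j<b , e = Equivalence.to (T-any-upTo _ b) t
             in  j , j<b , Equivalence.to (≡%ℕ⇔≡mod (toℕ<n _)) (ℕ.≡ᵇ⇒≡ _ _ e))
      (λ (j , j<b , e) → Equivalence.from (T-any-upTo _ b)
             (j , j<b , ℕ.≡⇒≡ᵇ _ _ (Equivalence.from (≡%ℕ⇔≡mod (toℕ<n _)) e)))

    shift : Fin N → Fin N
    shift y = reduce (+ toℕ y + + a * I)

    shift-injective : Injective _≡_ _≡_ shift
    shift-injective {x} {y} sx≡sy = toℕ-injective
      (residue-unique (toℕ<n x) (toℕ<n y) (+-cancelʳ-≡mod (+ a * I) (reduce-≡⇒≡mod sx≡sy)))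

    finds-shifted⇔Reaches : ∀ π k →
      T (finds N D I a (Vec.map shift π) k) ⇔ Reaches (start k) a (+ toℕ (lookup π k) + + a * I)
    finds-shifted⇔Reaches π k = mk⇔
      (λ t → Reaches-resp-≡mod (start k) (reduce-≡mod _)
               (subst (λ y → Reaches (start k) a (+ toℕ y)) (lookup-map k shift π)
                 (Equivalence.to (finds⇔Reaches a (Vec.map shift π) k) t)))
      (λ r → Equivalence.from (finds⇔Reaches a (Vec.map shift π) k)
               (subst (λ y → Reaches (start k) a (+ toℕ y)) (sym (lookup-map k shift π))
                 (Reaches-resp-≡mod (start k) (≡mod-sym (reduce-≡mod _)) r)))

    finds-complement : ∀ π k → finds N D I (N ∸ a) π k ≡ not (finds N D I a (Vec.map shift π) k)
    finds-complement π k = T-⇔⇒≡ (mk⇔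
      (λ t → Equivalence.from T-not⇔¬T
        (Reaches-shift-disjoint (start k) a≤N (Equivalence.to (finds⇔Reaches (N ∸ a) π k) t)
          ∘ Equivalence.to (finds-shifted⇔Reaches π k)))
      (λ t → Equivalence.from (finds⇔Reaches (N ∸ a) π k) (Reaches-shift-cover (start k) a≤N
        (Equivalence.to T-not⇔¬T t ∘ Equivalence.from (finds-shifted⇔Reaches π k)))))

    numFound-≤ : ∀ b π → numFound N D I b π ≤ N
    numFound-≤ b π = subst (numFound N D I b π ≤_) (length-tabulate (λ k → k)) (count-≤-length _ (allFin N))

    numFound-complement : ∀ π → numFound N D I (N ∸ a) π ≡ N ∸ numFound N D I a (Vec.map shift π)
    numFound-complement π = begin
      numFound N D I (N ∸ a) π                    ≡⟨ count-cong (finds-complement π) (allFin N) ⟩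
      count (not ∘ found) (allFin N)              ≡⟨ count-not found (allFin N) ⟩
      length (allFin N) ∸ count found (allFin N)
        ≡⟨ cong (_∸ count found (allFin N)) (length-tabulate (λ k → k)) ⟩
      N ∸ numFound N D I a (Vec.map shift π)      ∎
      where
      open ≡-Reasoning
      found : Fin N → Bool
      found = finds N D I a (Vec.map shift π)

    countBS-complement : ∀ {w} → w ≤ N → countBS N D I a w ≡ countBS N D I (N ∸ a) (N ∸ w)
    countBS-complement {w} w≤N = begin
      count (λ π → numFound N D I a π ≡ᵇ w) (bijections N)
        ≡⟨ count-↭ _ (bijections-map-↭ shift-injective) ⟨
      count (λ π → numFound N D I a π ≡ᵇ w) (map (Vec.map shift) (bijections N))
        ≡⟨ count-map _ (Vec.map shift) (bijections N) ⟩
      count (λ π → numFound N D I a (Vec.map shift π) ≡ᵇ w) (bijections N)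
        ≡⟨ count-cong complement (bijections N) ⟩
      count (λ π → numFound N D I (N ∸ a) π ≡ᵇ N ∸ w) (bijections N) ∎
      where
      open ≡-Reasoning
      complement : ∀ π → (numFound N D I a (Vec.map shift π) ≡ᵇ w) ≡ (numFound N D I (N ∸ a) π ≡ᵇ N ∸ w)
      complement π = trans (≡ᵇ-∸ (numFound-≤ a (Vec.map shift π)) w≤N)
                           (cong (_≡ᵇ N ∸ w) (sym (numFound-complement π)))

lemma2 : (N : ℕ) .{{_ : NonZero N}} (D I : ℤ) → Coprime N ∣ I ∣ →
           (a w : ℕ) → 1 ≤ a → a ≤ N → w ≤ N →
           P-BS N D I a w ≡ P-BS N D I (N ∸ a) (N ∸ w)
lemma2 N D I N⊥I a w _ a≤N w≤N =
  cong (λ c → _/_ (+ c) (N !) {{N ℕ.!≢0}}) (BoxStrategy.countBS-complement N I N⊥I D a≤N w≤N)
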